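{- Let $m$ be a positive integer with $m\equiv 10\pmod{12}$. Then the rose window graph $R_{12m}(3m+2,9m+1)$ is a Cayley graph.
   Context: For integers $n\ge 3$ and $1\le a,r\le n-1$, the rose window graph $R_n(a,r)$ has vertex set $\{A_i,B_i : i\in\mathbb{Z}_n\}$ and edges $A_iA_{i+1}$, $A_iB_i$, $A_{i+a}B_i$ and $B_iB_{i+r}$, indices taken modulo $n$. A graph is Cayley iff its automorphism group has a subgroup acting regularly on its vertices. -}

module Defs where

open import Level using (0ℓ)
open import Data.Nat using (ℕ; suc; _+_; _*_; NonZero)
open import Data.Nat.DivMod using (_mod_)
open import Data.Fin using (Fin; toℕ)
open import Data.Product using (Σ; _×_; _,_; ∃-syntax)
open import Data.Sum using (_⊎_)
open import Relation.Binary.PropositionalEquality using (_≡_)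
open import Function using (_∘_; id; _⇔_)

record Graph : Set₁ where
  field
    V   : Set
    Adj : V → V → Set

open Graph public

_≗ᵥ_ : {V : Set} → (V → V) → (V → V) → Set
f ≗ᵥ g = ∀ x → f x ≡ g x

record Automorphism (G : Graph) : Set where
  field
    fun     : V G → V G
    inv     : V G → V G
    inv-l   : ∀ x → inv (fun x) ≡ x
    inv-r   : ∀ x → fun (inv x) ≡ x
    adj-iff : ∀ u v → Adj G u v ⇔ Adj G (fun u) (fun v)

open Automorphism public

record RegularSubgroup (G : Graph) : Set₁ where
  field
    H        : Automorphism G → Set
    has-id   : ∃[ e ] (H e × (fun e ≗ᵥ id))
    has-comp : ∀ g h → H g → H h → ∃[ k ] (H k × (fun k ≗ᵥ (fun g ∘ fun h)))
    has-inv  : ∀ g → H g → ∃[ k ] (H k × (fun k ≗ᵥ inv g))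
    transitive : ∀ u v → ∃[ h ] (H h × (fun h u ≡ v))
    semiregular : ∀ g h → H g → H h → ∀ u → fun g u ≡ fun h u → fun g ≗ᵥ fun h

-- A graph is Cayley iff its automorphism group has a subgroup acting
-- regularly on its vertices.
IsCayley : Graph → Set₁
IsCayley G = RegularSubgroup G

_⊕_ : ∀ {n} .{{_ : NonZero n}} → Fin n → ℕ → Fin n
_⊕_ {n} i k = (toℕ i + k) mod n

infixl 6 _⊕_

data RoseVertex (n : ℕ) : Set where
  A : Fin n → RoseVertex n
  B : Fin n → RoseVertex n

RoseAdj : (n a r : ℕ) .{{_ : NonZero n}} → RoseVertex n → RoseVertex n → Set
RoseAdj n a r (A i) (A j) = (j ≡ i ⊕ 1) ⊎ (i ≡ j ⊕ 1)
RoseAdj n a r (A i) (B j) = (i ≡ j) ⊎ (i ≡ j ⊕ a)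
RoseAdj n a r (B j) (A i) = (i ≡ j) ⊎ (i ≡ j ⊕ a)
RoseAdj n a r (B i) (B j) = (j ≡ i ⊕ r) ⊎ (i ≡ j ⊕ r)

RoseWindow : (n a r : ℕ) .{{_ : NonZero n}} → Graph
RoseWindow n a r = record { V = RoseVertex n ; Adj = RoseAdj n a r }

-- The rotations  A_i ↦ A_{i+k}, B_i ↦ B_{i+k}  and the flips
-- A_i ↦ B_{ri+k}, B_i ↦ A_{ri+k+a}  are automorphisms of R_n(a,r) as soon as
-- r² ≡ 1 and ra ≡ a (mod n). These 2n maps are closed under composition and
-- inverses, and they act freely and transitively on the vertices (rotations move
-- along each side, flips exchange the sides), so they form a regular subgroup of
-- Aut(R_n(a,r)). For n = 12m, a = 3m+2, r = 9m+1 both congruences hold whenever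
-- m ≡ 2 (mod 4).
module Submission where

open import Defs
open import Level using (0ℓ)
open import Data.Nat using (ℕ; suc; _+_; _*_; _∸_; _%_; _/_; NonZero)
open import Data.Nat.Properties using (+-commutativeSemigroup; +-comm; +-assoc; *-identityʳ; *-zeroʳ; *-identityˡ; +-identityʳ; m+[n∸m]≡n; <⇒≤)
open import Data.Nat.DivMod
  using (_mod_; %-distribˡ-+; %-distribˡ-*; [m+kn]%n≡m%n; m%n%n≡m%n; m%n<n; m<n⇒m%n≡m; m≡m%n+[m/n]*n; m∣n⇒o%n%m≡o%m)
open import Data.Nat.Divisibility using (divides)
open import Data.Nat.Tactic.RingSolver using (solve-∀)
open import Algebra.Properties.CommutativeSemigroup +-commutativeSemigroup using (xy∙z≈xz∙y)
open import Data.Fin using (Fin; toℕ)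
open import Data.Fin.Properties using (toℕ-injective; toℕ-fromℕ<; toℕ<n)
open import Data.Product using (_,_; ∃-syntax)
import Data.Sum as Sum
open import Function using (_∘_; id; mk⇔)
open import Relation.Binary.Bundles using (Setoid)
open import Relation.Binary.PropositionalEquality
  using (_≡_; refl; sym; trans; cong; cong₂; subst₂; module ≡-Reasoning)
import Relation.Binary.PropositionalEquality as ≡
import Relation.Binary.Construct.On as On
import Relation.Binary.Reasoning.Setoid

record FreeTransitiveAction (G : Graph) : Set₁ where
  field
    Sym          : Set
    act          : Sym → V G → V G
    act-adj      : ∀ g {u v} → Adj G u v → Adj G (act g u) (act g v)
    _∙_          : Sym → Sym → Sym
    _⁻¹          : Sym → Sym
    act-∙        : ∀ g h → act (g ∙ h) ≗ᵥ (act g ∘ act h)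
    act-inverseˡ : ∀ g → (act (g ⁻¹) ∘ act g) ≗ᵥ id
    base         : V G
    orbit        : ∀ v → ∃[ g ] act g base ≡ v
    free         : ∀ g {u} → act g u ≡ u → act g ≗ᵥ id

  infixl 7 _∙_
  infix 8 _⁻¹

module _ {G : Graph} (T : FreeTransitiveAction G) where
  open FreeTransitiveAction T

  -- act (g ⁻¹) is injective, having act ((g ⁻¹) ⁻¹) as left inverse.
  act-inverseʳ : ∀ g → (act g ∘ act (g ⁻¹)) ≗ᵥ id
  act-inverseʳ g x = begin
    act g (act (g ⁻¹) x)                                   ≡⟨ sym (act-inverseˡ (g ⁻¹) _) ⟩
    act ((g ⁻¹) ⁻¹) (act (g ⁻¹) (act g (act (g ⁻¹) x)))  ≡⟨ cong (act ((g ⁻¹) ⁻¹)) (act-inverseˡ g _) ⟩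
    act ((g ⁻¹) ⁻¹) (act (g ⁻¹) x)                         ≡⟨ act-inverseˡ (g ⁻¹) x ⟩
    x                                                      ∎
    where open ≡-Reasoning

  act-agree : ∀ g h {u} → act g u ≡ act h u → act g ≗ᵥ act h
  act-agree g h {u} eq x = begin
    act g x                          ≡⟨ sym (act-inverseʳ h _) ⟩
    act h (act (h ⁻¹) (act g x))     ≡⟨ cong (act h) (sym (act-∙ (h ⁻¹) g x)) ⟩
    act h (act (h ⁻¹ ∙ g) x)         ≡⟨ cong (act h) (free (h ⁻¹ ∙ g) fixes-u x) ⟩
    act h x                          ∎
    where
      open ≡-Reasoning
      fixes-u : act (h ⁻¹ ∙ g) u ≡ u
      fixes-u = trans (act-∙ (h ⁻¹) g u)
                      (trans (cong (act (h ⁻¹)) eq) (act-inverseˡ h u))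

  automorphism : Sym → Automorphism G
  automorphism g = record
    { fun     = act g
    ; inv     = act (g ⁻¹)
    ; inv-l   = act-inverseˡ g
    ; inv-r   = act-inverseʳ g
    ; adj-iff = λ u v → mk⇔ (act-adj g)
        (subst₂ (Adj G) (act-inverseˡ g u) (act-inverseˡ g v) ∘ act-adj (g ⁻¹))
    }

  InducedBySym : Automorphism G → Set
  InducedBySym f = ∃[ g ] fun f ≗ᵥ act g

  freeTransitiveAction⇒isCayley : IsCayley G
  freeTransitiveAction⇒isCayley = record
    { H           = InducedBySym
    ; has-id      = let g , g-fixes-base = orbit base
                    in automorphism g , (g , λ _ → refl) , free g g-fixes-base
    ; has-comp    = λ { f f′ (g , f≗g) (h , f′≗h) → automorphism (g ∙ h) , (g ∙ h , λ _ → refl) ,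
                        λ x → trans (act-∙ g h x)
                                    (sym (trans (f≗g _) (cong (act g) (f′≗h x)))) }
    ; has-inv     = λ { f (g , f≗g) → automorphism (g ⁻¹) , (g ⁻¹ , λ _ → refl) ,
                        λ x → sym (trans (cong (inv f) (sym (trans (f≗g _) (act-inverseʳ g x))))
                                         (inv-l f _)) }
    ; transitive  = λ u v → let g , gb≡u = orbit u ; h , hb≡v = orbit v in
                      automorphism (h ∙ g ⁻¹) , (h ∙ g ⁻¹ , λ _ → refl) ,
                      trans (act-∙ h (g ⁻¹) u)
                            (trans (cong (act h ∘ act (g ⁻¹)) (sym gb≡u))
                                   (trans (cong (act h) (act-inverseˡ g base)) hb≡v))
    ; semiregular = λ { f f′ (g , f≗g) (h , f′≗h) u eq x →
                        trans (f≗g x) (trans (act-agree g h (trans (sym (f≗g u)) (trans eq (f′≗h u))) x)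
                                             (sym (f′≗h x))) }
    }

≡+kn⇒%≡ : ∀ {x} y k n .{{_ : NonZero n}} → x ≡ y + k * n → x % n ≡ y % n
≡+kn⇒%≡ y k n eq = trans (cong (_% n) eq) ([m+kn]%n≡m%n y k n)

module Modular (n : ℕ) .{{_ : NonZero n}} where

  ≈-setoid : Setoid 0ℓ 0ℓ
  ≈-setoid = On.setoid (≡.setoid ℕ) (_% n)

  open Setoid ≈-setoid public using (_≈_) renaming (refl to ≈-refl; sym to ≈-sym; trans to ≈-trans)
  module ≈-Reasoning = Relation.Binary.Reasoning.Setoid ≈-setoid

  ≡⇒≈ : ∀ {x y} → x ≡ y → x ≈ y
  ≡⇒≈ = cong (_% n)

  +-cong : ∀ {x x′ y y′} → x ≈ x′ → y ≈ y′ → x + y ≈ x′ + y′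
  +-cong {x} {x′} {y} {y′} x≈x′ y≈y′ = begin
    (x + y) % n              ≡⟨ %-distribˡ-+ x y n ⟩
    (x % n + y % n) % n      ≡⟨ cong₂ (λ u v → (u + v) % n) x≈x′ y≈y′ ⟩
    (x′ % n + y′ % n) % n    ≡⟨ sym (%-distribˡ-+ x′ y′ n) ⟩
    (x′ + y′) % n            ∎
    where open ≡-Reasoning

  *-cong : ∀ {x x′ y y′} → x ≈ x′ → y ≈ y′ → x * y ≈ x′ * y′
  *-cong {x} {x′} {y} {y′} x≈x′ y≈y′ = begin
    (x * y) % n              ≡⟨ %-distribˡ-* x y n ⟩
    (x % n * (y % n)) % n    ≡⟨ cong₂ (λ u v → (u * v) % n) x≈x′ y≈y′ ⟩
    (x′ % n * (y′ % n)) % n  ≡⟨ sym (%-distribˡ-* x′ y′ n) ⟩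
    (x′ * y′) % n            ∎
    where open ≡-Reasoning

  +-congˡ : ∀ x {y y′} → y ≈ y′ → x + y ≈ x + y′
  +-congˡ x = +-cong (≈-refl {x})

  +-congʳ : ∀ y {x x′} → x ≈ x′ → x + y ≈ x′ + y
  +-congʳ y x≈x′ = +-cong x≈x′ (≈-refl {y})

  *-congˡ : ∀ x {y y′} → y ≈ y′ → x * y ≈ x * y′
  *-congˡ x = *-cong (≈-refl {x})

  n≈0 : n ≈ 0
  n≈0 = ≡+kn⇒%≡ 0 1 n (sym (*-identityˡ n))

  neg : ℕ → ℕ
  neg x = n ∸ x % n

  +-neg≈0 : ∀ x → x + neg x ≈ 0
  +-neg≈0 x = begin
    x + neg x            ≈⟨ +-congʳ (neg x) (≈-sym (m%n%n≡m%n x n)) ⟩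
    x % n + (n ∸ x % n)  ≡⟨ m+[n∸m]≡n (<⇒≤ (m%n<n x n)) ⟩
    n                    ≈⟨ n≈0 ⟩
    0                    ∎
    where open ≈-Reasoning

  neg+≈0 : ∀ x → neg x + x ≈ 0
  neg+≈0 x = ≈-trans (≡⇒≈ (+-comm (neg x) x)) (+-neg≈0 x)

  +-cancelˡ-≈0 : ∀ x {k} → x + k ≈ x → k ≈ 0
  +-cancelˡ-≈0 x {k} x+k≈x = begin
    k                ≈⟨ +-congʳ k (≈-sym (neg+≈0 x)) ⟩
    neg x + x + k    ≡⟨ +-assoc (neg x) x k ⟩
    neg x + (x + k)  ≈⟨ +-congˡ (neg x) x+k≈x ⟩
    neg x + x        ≈⟨ neg+≈0 x ⟩
    0                ∎
    where open ≈-Reasoning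

  toℕ-mod : ∀ x → toℕ (x mod n) ≈ x
  toℕ-mod x = trans (cong (_% n) (toℕ-fromℕ< (m%n<n x n))) (m%n%n≡m%n x n)

  mod-cong : ∀ {x y} → x ≈ y → x mod n ≡ y mod n
  mod-cong x≈y = toℕ-injective (trans (toℕ-fromℕ< _) (trans x≈y (sym (toℕ-fromℕ< _))))

  mod-injective : ∀ {x y} → x mod n ≡ y mod n → x ≈ y
  mod-injective eq = trans (sym (toℕ-fromℕ< _)) (trans (cong toℕ eq) (toℕ-fromℕ< _))

  toℕ-mod-inverse : ∀ (i : Fin n) → toℕ i mod n ≡ i
  toℕ-mod-inverse i = toℕ-injective (trans (toℕ-fromℕ< _) (m<n⇒m%n≡m (toℕ<n i)))

  ≡⊕⇒≈ : ∀ {i : Fin n} j c → i ≡ j ⊕ c → toℕ i ≈ toℕ j + c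
  ≡⊕⇒≈ j c i≡j⊕c = ≈-trans (≡⇒≈ (cong toℕ i≡j⊕c)) (toℕ-mod _)

  ≈⇒≡⊕ : ∀ {x y} c → x ≈ y + c → x mod n ≡ y mod n ⊕ c
  ≈⇒≡⊕ {y = y} c x≈y+c = mod-cong (≈-trans x≈y+c (+-congʳ c (≈-sym (toℕ-mod y))))

  ⊕-identityʳ : ∀ (i : Fin n) {k} → k ≈ 0 → i ⊕ k ≡ i
  ⊕-identityʳ i k≈0 =
    trans (mod-cong (≈-trans (+-congˡ (toℕ i) k≈0) (≡⇒≈ (+-identityʳ (toℕ i))))) (toℕ-mod-inverse i)

  mod-⊕ : ∀ x c → x mod n ⊕ c ≡ (x + c) mod n
  mod-⊕ x c = mod-cong (+-congʳ c (toℕ-mod x))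

  ⊕-cancel : ∀ (i : Fin n) {k} → i ⊕ k ≡ i → k ≈ 0
  ⊕-cancel i i⊕k≡i = +-cancelˡ-≈0 (toℕ i) (mod-injective (trans i⊕k≡i (sym (toℕ-mod-inverse i))))

module RoseWindowSymmetries (n : ℕ) .{{_ : NonZero n}} (a r : ℕ) where
  open Modular n

  data Sym : Set where
    rot flip : ℕ → Sym

  act : Sym → RoseVertex n → RoseVertex n
  act (rot k)  (A i) = A (i ⊕ k)
  act (rot k)  (B i) = B (i ⊕ k)
  act (flip k) (A i) = B ((r * toℕ i + k) mod n)
  act (flip k) (B i) = A ((r * toℕ i + k + a) mod n)

  infixl 7 _∙_
  _∙_ : Sym → Sym → Sym
  rot k  ∙ rot l  = rot (l + k)
  rot k  ∙ flip l = flip (l + k)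
  flip k ∙ rot l  = flip (r * l + k)
  flip k ∙ flip l = rot (r * l + k + a)

  infix 8 _⁻¹
  _⁻¹ : Sym → Sym
  rot k ⁻¹  = rot (neg k)
  flip k ⁻¹ = flip (neg (r * k + a))

  ⊕-shift : ∀ {i j : Fin n} {c} k → j ≡ i ⊕ c → j ⊕ k ≡ i ⊕ k ⊕ c
  ⊕-shift {i} {j} {c} k j≡i⊕c = ≈⇒≡⊕ c (begin
    toℕ j + k      ≈⟨ +-congʳ k (≡⊕⇒≈ i c j≡i⊕c) ⟩
    toℕ i + c + k  ≡⟨ xy∙z≈xz∙y (toℕ i) c k ⟩
    toℕ i + k + c  ∎)
    where open ≈-Reasoning

  act-rot≈0 : ∀ {k} → k ≈ 0 → act (rot k) ≗ᵥ id
  act-rot≈0 k≈0 (A i) = cong A (⊕-identityʳ i k≈0)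
  act-rot≈0 k≈0 (B i) = cong B (⊕-identityʳ i k≈0)

  index : RoseVertex n → Fin n
  index (A i) = i
  index (B i) = i

  act-free : ∀ g {u} → act g u ≡ u → act g ≗ᵥ id
  act-free (rot k)  {A i} eq = act-rot≈0 (⊕-cancel i (cong index eq))
  act-free (rot k)  {B i} eq = act-rot≈0 (⊕-cancel i (cong index eq))
  act-free (flip k) {A i} ()
  act-free (flip k) {B i} ()

  base : RoseVertex n
  base = A (0 mod n)

  orbit : ∀ v → ∃[ g ] act g base ≡ v
  orbit (A j) = rot (toℕ j) , cong A (trans (mod-cong (+-congʳ (toℕ j) (toℕ-mod 0))) (toℕ-mod-inverse j))
  orbit (B j) = flip (toℕ j) , cong B (trans (mod-cong r*0+j≈j) (toℕ-mod-inverse j))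
    where
      r*0+j≈j : r * toℕ (0 mod n) + toℕ j ≈ toℕ j
      r*0+j≈j = ≈-trans (+-congʳ (toℕ j) (*-congˡ r (toℕ-mod 0))) (≡⇒≈ (cong (_+ toℕ j) (*-zeroʳ r)))

  module _ (r²≈1 : r * r ≈ 1) (ra≈a : r * a ≈ a) where

    scaled-shift : ∀ {x y} c k → x ≈ y + c → r * x + k ≈ r * y + k + r * c
    scaled-shift {x} {y} c k x≈y+c = begin
      r * x + k            ≈⟨ +-congʳ k (*-congˡ r x≈y+c) ⟩
      r * (y + c) + k      ≡⟨ e r y c k ⟩
      r * y + k + r * c    ∎
      where
        open ≈-Reasoning
        e : ∀ r y c k → r * (y + c) + k ≡ r * y + k + r * c
        e = solve-∀

    scaled-⊕ : ∀ (i : Fin n) l k → r * toℕ (i ⊕ l) + k ≈ r * toℕ i + (r * l + k)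
    scaled-⊕ i l k = ≈-trans (+-congʳ k (*-congˡ r (toℕ-mod _))) (≡⇒≈ (e r (toℕ i) l k))
      where e : ∀ r x l k → r * (x + l) + k ≡ r * x + (r * l + k)
            e = solve-∀

    flip-rim : ∀ {i j : Fin n} k → j ≡ i ⊕ 1 →
               (r * toℕ j + k) mod n ≡ (r * toℕ i + k) mod n ⊕ r
    flip-rim {i} k j≡i⊕1 =
      ≈⇒≡⊕ r (≈-trans (scaled-shift 1 k (≡⊕⇒≈ i 1 j≡i⊕1)) (≡⇒≈ (cong (r * toℕ i + k +_) (*-identityʳ r))))

    flip-spoke : ∀ {i j : Fin n} k → i ≡ j ⊕ a →
                 (r * toℕ j + k + a) mod n ≡ (r * toℕ i + k) mod n
    flip-spoke {i} {j} k i≡j⊕a = mod-cong (≈-sym (begin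
      r * toℕ i + k          ≈⟨ scaled-shift a k (≡⊕⇒≈ j a i≡j⊕a) ⟩
      r * toℕ j + k + r * a  ≈⟨ +-congˡ (r * toℕ j + k) ra≈a ⟩
      r * toℕ j + k + a      ∎))
      where open ≈-Reasoning

    flip-hub : ∀ {i j : Fin n} k → j ≡ i ⊕ r →
               (r * toℕ j + k + a) mod n ≡ (r * toℕ i + k + a) mod n ⊕ 1
    flip-hub {i} {j} k j≡i⊕r = ≈⇒≡⊕ 1 (begin
      r * toℕ j + k + a            ≈⟨ +-congʳ a (scaled-shift r k (≡⊕⇒≈ i r j≡i⊕r)) ⟩
      r * toℕ i + k + r * r + a    ≡⟨ xy∙z≈xz∙y (r * toℕ i + k) (r * r) a ⟩
      r * toℕ i + k + a + r * r    ≈⟨ +-congˡ (r * toℕ i + k + a) r²≈1 ⟩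
      r * toℕ i + k + a + 1        ∎)
      where open ≈-Reasoning

    act-adj : ∀ g {u v} → RoseAdj n a r u v → RoseAdj n a r (act g u) (act g v)
    act-adj (rot k)  {A i} {A j} = Sum.map (⊕-shift k) (⊕-shift k)
    act-adj (rot k)  {A i} {B j} = Sum.map (cong (_⊕ k)) (⊕-shift k)
    act-adj (rot k)  {B j} {A i} = Sum.map (cong (_⊕ k)) (⊕-shift k)
    act-adj (rot k)  {B i} {B j} = Sum.map (⊕-shift k) (⊕-shift k)
    act-adj (flip k) {A i} {A j} = Sum.map (flip-rim k) (flip-rim k)
    act-adj (flip k) {A i} {B j} = Sum.swap ∘ Sum.map (λ { refl → ≈⇒≡⊕ a ≈-refl }) (flip-spoke k)
    act-adj (flip k) {B j} {A i} = Sum.swap ∘ Sum.map (λ { refl → ≈⇒≡⊕ a ≈-refl }) (flip-spoke k)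
    act-adj (flip k) {B i} {B j} = Sum.map (flip-hub k) (flip-hub k)

    act-∙ : ∀ g h → act (g ∙ h) ≗ᵥ (act g ∘ act h)
    act-∙ (rot k)  (rot l)  (A i) = cong A (sym (trans (mod-⊕ _ k) (cong (_mod n) (+-assoc (toℕ i) l k))))
    act-∙ (rot k)  (rot l)  (B i) = cong B (sym (trans (mod-⊕ _ k) (cong (_mod n) (+-assoc (toℕ i) l k))))
    act-∙ (rot k)  (flip l) (A i) = cong B (sym (trans (mod-⊕ _ k) (cong (_mod n) (+-assoc (r * toℕ i) l k))))
    act-∙ (rot k)  (flip l) (B i) = cong A (sym (trans (mod-⊕ _ k) (cong (_mod n) (e (r * toℕ i) l a k))))
      where e : ∀ x l a k → x + l + a + k ≡ x + (l + k) + a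
            e = solve-∀
    act-∙ (flip k) (rot l)  (A i) = cong B (mod-cong (≈-sym (scaled-⊕ i l k)))
    act-∙ (flip k) (rot l)  (B i) = cong A (mod-cong (≈-sym (+-congʳ a (scaled-⊕ i l k))))
    act-∙ (flip k) (flip l) (A i) = cong A (mod-cong (≈-sym (begin
      r * toℕ ((r * toℕ i + l) mod n) + k + a  ≈⟨ +-congʳ a (+-congʳ k (*-congˡ r (toℕ-mod _))) ⟩
      r * (r * toℕ i + l) + k + a              ≡⟨ e r (toℕ i) l k a ⟩
      r * r * toℕ i + (r * l + k + a)          ≈⟨ +-congʳ (r * l + k + a) (*-cong r²≈1 (≈-refl {toℕ i})) ⟩
      1 * toℕ i + (r * l + k + a)              ≡⟨ cong (_+ (r * l + k + a)) (*-identityˡ (toℕ i)) ⟩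
      toℕ i + (r * l + k + a)                  ∎)))
      where
        open ≈-Reasoning
        e : ∀ r x l k a → r * (r * x + l) + k + a ≡ r * r * x + (r * l + k + a)
        e = solve-∀
    act-∙ (flip k) (flip l) (B i) = cong B (mod-cong (≈-sym (begin
      r * toℕ ((r * toℕ i + l + a) mod n) + k  ≈⟨ +-congʳ k (*-congˡ r (toℕ-mod _)) ⟩
      r * (r * toℕ i + l + a) + k              ≡⟨ e r (toℕ i) l k a ⟩
      r * r * toℕ i + (r * l + k + r * a)      ≈⟨ +-cong (*-cong r²≈1 (≈-refl {toℕ i})) (+-congˡ (r * l + k) ra≈a) ⟩
      1 * toℕ i + (r * l + k + a)              ≡⟨ cong (_+ (r * l + k + a)) (*-identityˡ (toℕ i)) ⟩
      toℕ i + (r * l + k + a)                  ∎)))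
      where
        open ≈-Reasoning
        e : ∀ r x l k a → r * (r * x + l + a) + k ≡ r * r * x + (r * l + k + r * a)
        e = solve-∀

    act-inverseˡ : ∀ g → (act (g ⁻¹) ∘ act g) ≗ᵥ id
    act-inverseˡ (rot k) x =
      trans (sym (act-∙ (rot (neg k)) (rot k) x)) (act-rot≈0 (+-neg≈0 k) x)
    act-inverseˡ (flip k) x =
      trans (sym (act-∙ (flip (neg (r * k + a))) (flip k) x)) (act-rot≈0 cancels x)
      where
        cancels : r * k + neg (r * k + a) + a ≈ 0
        cancels = ≈-trans (≡⇒≈ (xy∙z≈xz∙y (r * k) (neg (r * k + a)) a)) (+-neg≈0 (r * k + a))

    freeTransitiveAction : FreeTransitiveAction (RoseWindow n a r)
    freeTransitiveAction = record
      { Sym          = Sym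
      ; act          = act
      ; act-adj      = act-adj
      ; _∙_          = _∙_
      ; _⁻¹          = _⁻¹
      ; act-∙        = act-∙
      ; act-inverseˡ = act-inverseˡ
      ; base         = base
      ; orbit        = orbit
      ; free         = act-free
      }

roseWindow-isCayley : ∀ n .{{_ : NonZero n}} a r →
                      (r * r) % n ≡ 1 % n → (r * a) % n ≡ a % n → IsCayley (RoseWindow n a r)
roseWindow-isCayley n a r r²≈1 ra≈a =
  freeTransitiveAction⇒isCayley (RoseWindowSymmetries.freeTransitiveAction n a r r²≈1 ra≈a)

square-9m+1 : ∀ t m → m ≡ 2 + t * 4 → (9 * m + 1) * (9 * m + 1) ≡ 1 + (27 * t + 15) * (12 * m)
square-9m+1 t m refl = e t
  where e : ∀ t → (9 * (2 + t * 4) + 1) * (9 * (2 + t * 4) + 1)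
                  ≡ 1 + (27 * t + 15) * (12 * (2 + t * 4))
        e = solve-∀

[9m+1][3m+2] : ∀ t m → m ≡ 2 + t * 4 → (9 * m + 1) * (3 * m + 2) ≡ 3 * m + 2 + (9 * t + 6) * (12 * m)
[9m+1][3m+2] t m refl = e t
  where e : ∀ t → (9 * (2 + t * 4) + 1) * (3 * (2 + t * 4) + 2)
                  ≡ 3 * (2 + t * 4) + 2 + (9 * t + 6) * (12 * (2 + t * 4))
        e = solve-∀

mainTheorem16 : (k : ℕ) → let m = suc k in m % 12 ≡ 10 →
    IsCayley (RoseWindow (12 * m) (3 * m + 2) (9 * m + 1))
mainTheorem16 k m%12≡10 = roseWindow-isCayley (12 * m) (3 * m + 2) (9 * m + 1)
  (≡+kn⇒%≡ 1 (27 * t + 15) (12 * m) (square-9m+1 t m m≡2+4t))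
  (≡+kn⇒%≡ (3 * m + 2) (9 * t + 6) (12 * m) ([9m+1][3m+2] t m m≡2+4t))
  where
    m = suc k
    t = m / 4
    m%4≡2 : m % 4 ≡ 2
    m%4≡2 = trans (sym (m∣n⇒o%n%m≡o%m 4 12 m (divides 3 refl))) (cong (_% 4) m%12≡10)
    m≡2+4t : m ≡ 2 + t * 4
    m≡2+4t = trans (m≡m%n+[m/n]*n m 4) (cong (_+ t * 4) m%4≡2)
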